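{- Let $R\in\Sigma'\subseteq\Sigma$, let $(M,a),(N,b)$ be pointed $\Sigma'$-models and let $A$ be an $\langle(M,a),(N,b)\rangle$-asimulation. Let $A'$ be the set of all pairs $\langle(c_1,\dots,c_n,c'),(d_1,\dots,d_n,d')\rangle$ with $n\ge 0$, $(c_1,\dots,c_n,c')\in D(\alpha)^{n+1}$, $(d_1,\dots,d_n,d')\in D(\beta)^{n+1}$ for some $\alpha,\beta\in\{M,N\}$, such that $c'Ad'$. Then $A'$ is an $\langle(M,a),(N,b)\rangle_k$-asimulation for every $k\in\mathbb{N}$.
   Context: Models are models of classical first-order logic with identity in sub-vocabularies of $\Sigma=\{R,P_1,P_2,\dots\}$, $R$ binary, each $P_n$ unary. A pointed model is $(M,a)$ with $a\in D(M)$; $M,a\models P(x)$ means $a\in P^M$. Asimulation: a relation $A\subseteq(D(M)\times D(N))\cup(D(N)\times D(M))$ is an $\langle(M,a),(N,b)\rangle$-asimulation iff $aAb$ and for all $\alpha,\beta\in\{M,N\}$, $a'\in D(\alpha)$, $b'\in D(\beta)$ with $a'Ab'$: (1) for every unary $P\in\Sigma'$, $\alpha,a'\models P(x)$ implies $\beta,b'\models P(x)$; (2) if $b''\in D(\beta)$ and $b'R^\beta b''$ then some $a''\in D(\alpha)$ has $a'R^\alpha a''$, $b''Aa''$ and $a''Ab''$. $k$-asimulation: a relation $A\subseteq\bigcup_{n>0}((D(M)^n\times D(N)^n)\cup(D(N)^n\times D(M)^n))$ is an $\langle(M,a),(N,b)\rangle_k$-asimulation iff $(a)A(b)$ and for all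 $\alpha,\beta\in\{M,N\}$, $(a'_1,\dots,a'_m,a')\in D(\alpha)^{m+1}$, $(b'_1,\dots,b'_m,b')\in D(\beta)^{m+1}$ with $(a'_1,\dots,a'_m,a')A(b'_1,\dots,b'_m,b')$: (1) for every unary $P\in\Sigma'$, $\alpha,a'\models P(x)$ implies $\beta,b'\models P(x)$; (2) if $b''\in D(\beta)$, $b'R^\beta b''$ and $m<k$, then some $a''\in D(\alpha)$ has $a'R^\alpha a''$, $(b'_1,\dots,b'_m,b',b'')A(a'_1,\dots,a'_m,a',a'')$ and $(a'_1,\dots,a'_m,a',a'')A(b'_1,\dots,b'_m,b',b'')$. -}

module Defs where

open import Data.Nat using (ℕ; suc; _<_)
open import Data.Vec using (Vec; []; _∷ʳ_)
open import Data.Product using (Σ; _×_; _,_)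

-- A sub-vocabulary Σ' ⊆ Σ = {R, P₁, P₂, …} containing R is given by
-- the predicate  Sig : ℕ → Set  saying which unary symbols P_n belong to Σ'.
record Model (Sig : ℕ → Set) : Set₁ where
  field
    D    : Set
    Rel  : D → D → Set
    Pred : (n : ℕ) → Sig n → D → Set
open Model public

-- The two models M, N are indexed by a side; domains are kept disjoint (tagged).
data Side : Set where
  sM sN : Side

data Cross : Side → Side → Set where
  MN : Cross sM sN
  NM : Cross sN sM

swap : ∀ {α β} → Cross α β → Cross β α
swap MN = NM
swap NM = MN

module _ {Sig : ℕ → Set} (M N : Model Sig) where

  Mod : Side → Model Sig
  Mod sM = M
  Mod sN = N

  Dom : Side → Set
  Dom s = D (Mod s)

  -- A relation ⊆ (D(M) × D(N)) ∪ (D(N) × D(M)) : for each side s, pairs D(s) × D(flip s).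
  BinRel : Set₁
  BinRel = ∀ {α β} → Cross α β → Dom α → Dom β → Set

  IsAsimulation : Dom sM → Dom sN → BinRel → Set
  IsAsimulation a b A =
    A MN a b ×
    (∀ {α β} (c : Cross α β) (a' : Dom α) (b' : Dom β) → A c a' b' →
       ((n : ℕ) (p : Sig n) → Pred (Mod α) n p a' → Pred (Mod β) n p b') ×
       ((b'' : Dom β) → Rel (Mod β) b' b'' →
          Σ (Dom α) λ a'' → Rel (Mod α) a' a'' × A (swap c) b'' a'' × A c a'' b''))

  -- A relation on tuples of equal positive length m+1, across the two models.
  -- A tuple (c₁,…,c_m,c') is represented as the vector (c₁,…,c_m) together with c'.
  TupRel : Set₁
  TupRel = ∀ {α β} → Cross α β → (m : ℕ) → Vec (Dom α) m → Dom α
                                 → Vec (Dom β) m → Dom β → Set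

  IsKAsimulation : ℕ → Dom sM → Dom sN → TupRel → Set
  IsKAsimulation k a b A =
    A MN 0 [] a [] b ×
    (∀ {α β} (c : Cross α β) (m : ℕ) (as : Vec (Dom α) m) (a' : Dom α)
       (bs : Vec (Dom β) m) (b' : Dom β) → A c m as a' bs b' →
       ((n : ℕ) (p : Sig n) → Pred (Mod α) n p a' → Pred (Mod β) n p b') ×
       ((b'' : Dom β) → Rel (Mod β) b' b'' → m < k →
          Σ (Dom α) λ a'' → Rel (Mod α) a' a'' ×
            A (swap c) (suc m) (bs ∷ʳ b') b'' (as ∷ʳ a') a'' ×
            A c (suc m) (as ∷ʳ a') a'' (bs ∷ʳ b') b''))

  liftRel : BinRel → TupRel
  liftRel A c m cs c' ds d' = A c c' d'

module Submission where

open import Defs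
open import Data.Nat using (ℕ)
open import Data.Product using (_,_; proj₁; proj₂)

lemma5 : {Sig : ℕ → Set} (M N : Model Sig) (a : Dom M N sM) (b : Dom M N sN)
         (A : BinRel M N) → IsAsimulation M N a b A →
         (k : ℕ) → IsKAsimulation M N k a b (liftRel M N A)
-- A' only inspects last elements, so each k-step is an asimulation step.
lemma5 M N a b A (aAb , back-and-forth) k =
  aAb , λ c m as a' bs b' a'Ab' →
    let step = back-and-forth c a' b' a'Ab'
    in proj₁ step , λ b'' b'Rb'' _ → proj₂ step b'' b'Rb''
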